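{- Let $q\ge 5$ be a prime power. For every integer $k$ with $2q\le k\le 3q-5$ there exists a minimal blocking set of size $k$ in $\mathrm{PG}(2,q)$ which has the $r_\infty$-property (with respect to some of its points) and which is not a blocking semioval.
   Context: A blocking set of $\mathrm{PG}(2,q)$ is a set of points meeting every line and containing no line; minimal if no proper subset is a blocking set. A line is tangent to a point set $\mathcal{K}$ if it meets $\mathcal{K}$ in exactly one point, secant if in more than one. A blocking set $\mathcal{B}$ has the $r_\infty$-property with respect to $P\in\mathcal{B}$ if exactly one line through $P$ is tangent to $\mathcal{B}$ and all other lines through $P$ are secants. A semioval is a point set $\mathcal{K}$ such that through each point of $\mathcal{K}$ there is exactly one tangent line to $\mathcal{K}$; a blocking semioval is a blocking set which is a semioval. -}

module Defs where

open import Data.Nat using (ℕ; suc; _^_)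
open import Data.Nat.Primality using (Prime)
open import Data.Fin using (Fin)
open import Data.Product using (Σ; ∃; _×_; _,_)
open import Data.List using (List)
open import Data.List.Membership.Propositional using (_∈_; _∉_)
open import Relation.Binary.PropositionalEquality using (_≡_; _≢_)
open import Relation.Nullary using (¬_)
open import Algebra.Structures using (IsCommutativeRing)

IsPrimePower : ℕ → Set
IsPrimePower q = Σ ℕ λ p → Σ ℕ λ n → Prime p × q ≡ p ^ suc n

-- A field structure on the q-element set Fin q (any field of order q is
-- isomorphic to one of these, so these are exactly the models of GF(q)).
record FieldOn (q : ℕ) : Set where
  infixl 6 _+_
  infixl 7 _*_
  field
    _+_ _*_  : Fin q → Fin q → Fin q
    -_       : Fin q → Fin q
    0# 1#    : Fin q
    isCommutativeRing : IsCommutativeRing _≡_ _+_ _*_ -_ 0# 1#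
    0≢1      : 0# ≢ 1#
    inverse  : ∀ x → x ≢ 0# → ∃ λ y → x * y ≡ 1#

module PG {q : ℕ} (F : FieldOn q) where
  open FieldOn F

  -- Points = 1-dim subspaces of F^3, given by their normalised
  -- representative: (1,a,b), (0,1,b) or (0,0,1).
  data Point : Set where
    pt1 : Fin q → Fin q → Point
    pt2 : Fin q → Point
    pt3 : Point

  -- Lines = 2-dim subspaces, given by normalised dual coordinates
  -- [u0:u1:u2] (same normal form as points).
  Line : Set
  Line = Point

  coord₀ coord₁ coord₂ : Point → Fin q
  coord₀ (pt1 a b) = 1#
  coord₀ (pt2 b)   = 0#
  coord₀ pt3       = 0#
  coord₁ (pt1 a b) = a
  coord₁ (pt2 b)   = 1#
  coord₁ pt3       = 0#
  coord₂ (pt1 a b) = b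
  coord₂ (pt2 b)   = b
  coord₂ pt3       = 1#

  _on_ : Point → Line → Set
  P on L = coord₀ L * coord₀ P + coord₁ L * coord₁ P + coord₂ L * coord₂ P ≡ 0#

  -- Point sets are lists of points (duplicate-free where size matters).
  PointSet : Set
  PointSet = List Point

  Tangent : PointSet → Line → Set
  Tangent K L = Σ Point λ P → P ∈ K × P on L × (∀ Q → Q ∈ K → Q on L → Q ≡ P)

  Secant : PointSet → Line → Set
  Secant K L = Σ Point λ P → Σ Point λ Q →
    P ≢ Q × P ∈ K × Q ∈ K × P on L × Q on L

  IsBlockingSet : PointSet → Set
  IsBlockingSet B =
    (∀ L → Σ Point λ P → P ∈ B × P on L) ×
    (∀ L → Σ Point λ P → P on L × P ∉ B)

  IsMinimalBlockingSet : PointSet → Set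
  IsMinimalBlockingSet B = IsBlockingSet B ×
    (∀ (B' : PointSet) → (∀ P → P ∈ B' → P ∈ B) →
       (Σ Point λ P → P ∈ B × P ∉ B') → ¬ IsBlockingSet B')

  HasRInfProperty : PointSet → Point → Set
  HasRInfProperty B P = P ∈ B ×
    (Σ Line λ L → P on L × Tangent B L ×
       (∀ M → P on M → M ≢ L → Secant B M))

  IsSemioval : PointSet → Set
  IsSemioval K = ∀ P → P ∈ K →
    Σ Line λ L → P on L × Tangent K L ×
      (∀ M → P on M → Tangent K M → M ≡ L)

  IsBlockingSemioval : PointSet → Set
  IsBlockingSemioval B = IsBlockingSet B × IsSemioval B

{-# OPTIONS --safe #-}
-- Write pt1 x y as the affine point (x,y) and pt2 b as the point at infinity of slope b.
-- Split the nonzero field elements into an "axial" set X and a "diagonal" set D ∋ ±1, and let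
-- B consist of the points at infinity of nonzero slope, the points (c,0) and (0,c) for c ∈ X, and
-- (c,c) for c ∈ D; then |B| = 2q - 2 + |X|, and |X| = k - 2q + 2 ranges over [2, q - 3].
-- Every point of B lies on a tangent (a vertical or horizontal line for the affine points; the line
-- through the origin, or y = x + 1 for slope 1, for the points at infinity), so B is minimal.
-- At (c₁,0) the only tangent is x = c₁: the x-axis contains a second point (c₂,0), and every other
-- line meets infinity in a point of nonzero slope. Finally (1,1) lies on the two tangents x = 1 and
-- y = 1, so B is not a semioval.
module Submission where

open import Defs
open import Algebra.Bundles using (CommutativeRing)
open import Algebra.Structures using (IsCommutativeRing)
import Algebra.Properties.Group as GroupProperties
open import Data.Empty using (⊥-elim)
open import Data.Fin using (Fin; zero; suc)
open import Data.Fin.Properties using (_≟_; pigeonhole; any?; ¬∀⟶∃¬) renaming (<⇒≢ to <⇒≢ᶠ)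
open import Data.List
  using (List; []; _∷_; _++_; length; concat; map; filter; take; drop; allFin; deduplicate)
open import Data.List.Properties
  using (length-++; length-map; length-tabulate; length-take; length-deduplicate; take++drop≡id; ++-assoc)
open import Data.List.Relation.Unary.Any using (Any; here; there)
import Data.List.Relation.Unary.All as All
import Data.List.Relation.Unary.All.Properties as All
open import Data.List.Relation.Unary.AllPairs as AllPairs using ([]; _∷_)
open import Data.List.Membership.Propositional using (_∈_; _∉_)
open import Data.List.Membership.Propositional.Properties
  using (∈-++⁺ˡ; ∈-++⁺ʳ; ∈-++⁻; ∈-map⁺; ∈-map⁻; ∈-concat⁺; ∈-concat⁻; ∈-filter⁺; ∈-filter⁻; ∈-allFin;
         ∈-deduplicate⁺; ∈-deduplicate⁻)
open import Data.List.Membership.Propositional.Properties.WithK using (unique∧set⇒bag)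
open import Data.List.Relation.Binary.BagAndSetEquality using (∼bag⇒↭)
open import Data.List.Relation.Binary.Permutation.Propositional.Properties using (↭-length)
open import Data.List.Relation.Binary.Disjoint.Propositional using (Disjoint)
open import Data.List.Relation.Unary.Unique.Propositional using (Unique)
import Data.List.Relation.Unary.Unique.Propositional.Properties as Unique
open import Data.Nat as ℕ using (ℕ; suc; _≤_; _<_; s≤s)
open import Data.Nat.ListAction using (sum)
open import Data.Nat.Properties
  using (≤-trans; +-monoʳ-≤; +-suc; +-cancelʳ-≤; m≤n⇒m⊓n≡m; m≤n⇒∃[o]m+o≡n; module ≤-Reasoning)
open import Data.Nat.Tactic.RingSolver using (solve-∀)
open import Data.Product using (Σ; ∃; ∃₂; _×_; _,_; proj₁; proj₂)
open import Data.Sum using (_⊎_; inj₁; inj₂)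
open import Function using (_∘_)
open import Function.Bundles using (_⇔_; mk⇔)
open import Level using (Level)
open import Relation.Binary.PropositionalEquality
open import Relation.Nullary using (¬_; yes; no; ¬?)
open import Relation.Unary using (Pred; Decidable)

private
  variable
    a ℓ : Level
    A C : Set a

AtMostOne : Pred A ℓ → Set _
AtMostOne P = ∀ {s t} → P s → P t → s ≡ t

∃-avoiding : ∀ {m n} → m < n → (P : Fin m → Pred (Fin n) ℓ) →
             (∀ i → Decidable (P i)) → (∀ i → AtMostOne (P i)) →
             ∃ λ t → ∀ i → ¬ P i t
∃-avoiding {n = n} m<n P P? P-unique =
  let t , t∉⋃P = ¬∀⟶∃¬ n _ (λ t → any? (λ i → P? i t)) ¬covered
  in t , λ i Pit → t∉⋃P (i , Pit)
  where
    ¬covered : ¬ (∀ t → ∃ λ i → P i t)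
    ¬covered cover with s , t , s<t , same ← pigeonhole m<n (proj₁ ∘ cover) =
      <⇒≢ᶠ s<t (P-unique _ (subst (λ i → P i s) same (proj₂ (cover s))) (proj₂ (cover t)))

unique-complete⇒length : ∀ {n} {xs : List (Fin n)} → Unique xs → (∀ x → x ∈ xs) → length xs ≡ n
unique-complete⇒length {n} {xs} xs! complete =
  trans (↭-length (∼bag⇒↭ (unique∧set⇒bag xs! (Unique.allFin⁺ n) same-members)))
        (length-tabulate (λ i → i))
  where
    same-members : ∀ {x} → (x ∈ xs) ⇔ (x ∈ allFin n)
    same-members {x} = mk⇔ (λ _ → ∈-allFin x) (λ _ → complete x)

Unique-++⁻ : ∀ (xs : List A) {ys} → Unique (xs ++ ys) → Unique xs × Unique ys × Disjoint xs ys
Unique-++⁻ []       ys!            = [] , ys! , λ ()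
Unique-++⁻ (x ∷ xs) (x∉xs++ys ∷ u) with xs! , ys! , xs∩ys ← Unique-++⁻ xs u =
  All.++⁻ˡ xs x∉xs++ys ∷ xs! , ys! , λ where
    (here refl , y∈ys) → All.lookup x∉xs++ys (∈-++⁺ʳ xs y∈ys) refl
    (there y∈xs , y∈ys) → xs∩ys (y∈xs , y∈ys)

distinct-pair : ∀ {xs : List A} → Unique xs → 2 ≤ length xs → ∃₂ λ x y → x ∈ xs × y ∈ xs × x ≢ y
distinct-pair {xs = x ∷ y ∷ _} ((x≢y All.∷ _) ∷ _) _ = x , y , here refl , there (here refl) , x≢y
distinct-pair {xs = _ ∷ []} _ (s≤s ())

map-disjoint : ∀ {f g : A → C} {xs ys} → (∀ {x y} → x ∈ xs → y ∈ ys → f x ≢ g y) →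
               Disjoint (map f xs) (map g ys)
map-disjoint {f = f} {g} f≢g (fx∈ , gy∈)
  with x , x∈ , refl ← ∈-map⁻ f fx∈ | y , y∈ , eq ← ∈-map⁻ g gy∈ = f≢g x∈ y∈ eq

length-concat : ∀ (xss : List (List A)) → length (concat xss) ≡ sum (map length xss)
length-concat []         = refl
length-concat (xs ∷ xss) = trans (length-++ xs) (cong (length xs ℕ.+_) (length-concat xss))

module FieldProperties {q : ℕ} (F : FieldOn q) where
  open FieldOn F
  open IsCommutativeRing isCommutativeRing public
    using (+-assoc; +-identityˡ; +-identityʳ; -‿inverseʳ; *-comm; *-assoc; *-identityˡ; *-identityʳ;
           zeroˡ; zeroʳ; distribʳ)

  private
    commutativeRing : CommutativeRing _ _
    commutativeRing = record { isCommutativeRing = isCommutativeRing }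

  open GroupProperties (CommutativeRing.+-group commutativeRing) using (inverseʳ-unique)

  1≢0 : 1# ≢ 0#
  1≢0 = 0≢1 ∘ sym

  -1≢0 : - 1# ≢ 0#
  -1≢0 -1≡0 = 1≢0 (trans (sym (+-identityʳ 1#)) (trans (cong (1# +_) (sym -1≡0)) (-‿inverseʳ 1#)))

  x+0y≡x : ∀ x y → x + 0# * y ≡ x
  x+0y≡x x y = trans (cong (x +_) (zeroˡ y)) (+-identityʳ x)

  x+y0≡x : ∀ x y → x + y * 0# ≡ x
  x+y0≡x x y = trans (cong (x +_) (zeroʳ y)) (+-identityʳ x)

  *-cancelˡ : ∀ {x y z} → x ≢ 0# → x * y ≡ x * z → y ≡ z
  *-cancelˡ {x} {y} {z} x≢0 xy≡xz = begin
    y              ≡⟨ *-identityˡ y ⟨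
    1# * y         ≡⟨ cong (_* y) x⁻¹x≡1 ⟨
    (x⁻¹ * x) * y  ≡⟨ *-assoc x⁻¹ x y ⟩
    x⁻¹ * (x * y)  ≡⟨ cong (x⁻¹ *_) xy≡xz ⟩
    x⁻¹ * (x * z)  ≡⟨ *-assoc x⁻¹ x z ⟨
    (x⁻¹ * x) * z  ≡⟨ cong (_* z) x⁻¹x≡1 ⟩
    1# * z         ≡⟨ *-identityˡ z ⟩
    z              ∎
    where
      open ≡-Reasoning
      x⁻¹ = proj₁ (inverse x x≢0)
      x⁻¹x≡1 : x⁻¹ * x ≡ 1#
      x⁻¹x≡1 = trans (*-comm x⁻¹ x) (proj₂ (inverse x x≢0))

  zero-product : ∀ {x y} → x * y ≡ 0# → x ≢ 0# → y ≡ 0#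
  zero-product {x} xy≡0 x≢0 = *-cancelˡ x≢0 (trans xy≡0 (sym (zeroʳ x)))

  linear-solvable : ∀ c {b} → b ≢ 0# → ∃ λ y → c + b * y ≡ 0#
  linear-solvable c {b} b≢0 = b⁻¹ * - c , (begin
    c + b * (b⁻¹ * - c)  ≡⟨ cong (c +_) (*-assoc b b⁻¹ (- c)) ⟨
    c + (b * b⁻¹) * - c  ≡⟨ cong (λ u → c + u * - c) (proj₂ (inverse b b≢0)) ⟩
    c + 1# * - c         ≡⟨ cong (c +_) (*-identityˡ (- c)) ⟩
    c + - c              ≡⟨ -‿inverseʳ c ⟩
    0#                   ∎)
    where
      open ≡-Reasoning
      b⁻¹ = proj₁ (inverse b b≢0)

  linear-unique : ∀ {c b y y′} → b ≢ 0# → c + b * y ≡ 0# → c + b * y′ ≡ 0# → y ≡ y′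
  linear-unique {c} b≢0 e e′ =
    *-cancelˡ b≢0 (trans (inverseʳ-unique c _ e) (sym (inverseʳ-unique c _ e′)))

  linear-root-nonzero : ∀ {c b y} → c ≢ 0# → c + b * y ≡ 0# → y ≢ 0#
  linear-root-nonzero {c} {b} c≢0 e refl = c≢0 (trans (sym (x+y0≡x c b)) e)

  linear-coefficient-nonzero : ∀ {c b y} → c ≢ 0# → c + b * y ≡ 0# → b ≢ 0#
  linear-coefficient-nonzero {c} {y = y} c≢0 e refl = c≢0 (trans (sym (x+0y≡x c y)) e)

  linear-swap : ∀ {c b y} → c + b * y ≡ 0# → c + y * b ≡ 0#
  linear-swap {c} {b} {y} = trans (cong (c +_) (*-comm y b))

  ∃-coefficient : ∀ {x} → x ≢ 0# → ∃ λ a → 1# + a * x ≡ 0#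
  ∃-coefficient x≢0 with a , e ← linear-solvable 1# x≢0 = a , linear-swap e

  coefficient-unique : ∀ {a a′ x} → 1# + a * x ≡ 0# → 1# + a′ * x ≡ 0# → a ≡ a′
  coefficient-unique e e′ =
    linear-unique (linear-root-nonzero 1≢0 e) (linear-swap e) (linear-swap e′)

  1+1·-1≡0 : 1# + 1# * - 1# ≡ 0#
  1+1·-1≡0 = trans (cong (1# +_) (*-identityˡ (- 1#))) (-‿inverseʳ 1#)

  1+-1·1≡0 : 1# + - 1# * 1# ≡ 0#
  1+-1·1≡0 = trans (cong (1# +_) (*-identityʳ (- 1#))) (-‿inverseʳ 1#)

  1+x-x≡1 : ∀ x → 1# + 1# * x + - 1# * x ≡ 1#
  1+x-x≡1 x = begin
    1# + 1# * x + - 1# * x    ≡⟨ +-assoc 1# _ _ ⟩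
    1# + (1# * x + - 1# * x)  ≡⟨ cong (1# +_) (distribʳ x 1# (- 1#)) ⟨
    1# + (1# + - 1#) * x      ≡⟨ cong (λ u → 1# + u * x) (-‿inverseʳ 1#) ⟩
    1# + 0# * x               ≡⟨ x+0y≡x 1# x ⟩
    1#                        ∎
    where open ≡-Reasoning

  x+cx≡[1+c]x : ∀ c x → x + c * x ≡ (1# + c) * x
  x+cx≡[1+c]x c x = trans (cong (_+ c * x) (sym (*-identityˡ x))) (sym (distribʳ x 1# c))

  1+ax+bx≡1+[a+b]x : ∀ a b x → 1# + a * x + b * x ≡ 1# + (a + b) * x
  1+ax+bx≡1+[a+b]x a b x = trans (+-assoc 1# _ _) (cong (1# +_) (sym (distribʳ x a b)))

  root-unique : ∀ {a x x′} → 1# + a * x ≡ 0# → 1# + a * x′ ≡ 0# → x ≡ x′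
  root-unique e = linear-unique (linear-coefficient-nonzero 1≢0 e) e

module Incidence {q : ℕ} (F : FieldOn q) where
  open FieldOn F
  open FieldProperties F
  open PG F

  private
    sum₃ : ∀ {x x′ y y′ z z′} → x ≡ x′ → y ≡ y′ → z ≡ z′ → x + y + z ≡ x′ + y′ + z′
    sum₃ refl refl refl = refl

    0+x+y≡x+y : ∀ x y → 0# + x + y ≡ x + y
    0+x+y≡x+y x y = cong (_+ y) (+-identityˡ x)

    0+0+x≡x : ∀ x → 0# + 0# + x ≡ x
    0+0+x≡x x = trans (0+x+y≡x+y 0# x) (+-identityˡ x)

  -- the bilinear form of _on_, with the products by the normalised coordinates 0# and 1# evaluated
  _·_ : Line → Point → Fin q
  pt1 u v · pt1 x y = 1# + u * x + v * y
  pt1 u v · pt2 y   = u + v * y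
  pt1 u v · pt3     = v
  pt2 v   · pt1 x y = x + v * y
  pt2 v   · pt2 y   = 1# + v * y
  pt2 v   · pt3     = v
  pt3     · pt1 x y = y
  pt3     · pt2 y   = y
  pt3     · pt3     = 1#

  ·-correct : ∀ L P → coord₀ L * coord₀ P + coord₁ L * coord₁ P + coord₂ L * coord₂ P ≡ L · P
  ·-correct (pt1 u v) (pt1 x y) = sum₃ (*-identityˡ 1#) refl refl
  ·-correct (pt1 u v) (pt2 y)   = trans (sum₃ (zeroʳ 1#) (*-identityʳ u) refl) (0+x+y≡x+y u (v * y))
  ·-correct (pt1 u v) pt3       = trans (sum₃ (zeroʳ 1#) (zeroʳ u) (*-identityʳ v)) (0+0+x≡x v)
  ·-correct (pt2 v)   (pt1 x y) = trans (sum₃ (zeroˡ 1#) (*-identityˡ x) refl) (0+x+y≡x+y x (v * y))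
  ·-correct (pt2 v)   (pt2 y)   = trans (sum₃ (zeroˡ 0#) (*-identityˡ 1#) refl) (0+x+y≡x+y 1# (v * y))
  ·-correct (pt2 v)   pt3       = trans (sum₃ (zeroˡ 0#) (zeroʳ 1#) (*-identityʳ v)) (0+0+x≡x v)
  ·-correct pt3       (pt1 x y) = trans (sum₃ (zeroˡ 1#) (zeroˡ x) (*-identityˡ y)) (0+0+x≡x y)
  ·-correct pt3       (pt2 y)   = trans (sum₃ (zeroˡ 0#) (zeroˡ 1#) (*-identityˡ y)) (0+0+x≡x y)
  ·-correct pt3       pt3       = trans (sum₃ (zeroˡ 0#) (zeroˡ 0#) (*-identityˡ 1#)) (0+0+x≡x 1#)

  on⁺ : ∀ L P → L · P ≡ 0# → P on L
  on⁺ L P = trans (·-correct L P)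

  on⁻ : ∀ L P → P on L → L · P ≡ 0#
  on⁻ L P = trans (sym (·-correct L P))

module PlaneProperties {q : ℕ} (F : FieldOn q) where
  open PG F

  -- a blocking set without the point P no longer blocks the tangent at P
  tangents-everywhere⇒minimal : ∀ {B} → IsBlockingSet B →
    (∀ P → P ∈ B → Σ Line λ L → P on L × Tangent B L) → IsMinimalBlockingSet B
  tangents-everywhere⇒minimal {B} blocking tangent = blocking , no-smaller
    where
      no-smaller : ∀ B′ → (∀ P → P ∈ B′ → P ∈ B) → (Σ Point λ P → P ∈ B × P ∉ B′) → ¬ IsBlockingSet B′
      no-smaller B′ B′⊆B (P , P∈B , P∉B′) (meets , _) =
        let L , P-on-L , _ , _ , _ , only = tangent P P∈B
            Q , Q∈B′ , Q-on-L = meets L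
        in P∉B′ (subst (_∈ B′) (trans (only Q (B′⊆B Q Q∈B′) Q-on-L) (sym (only P P∈B P-on-L))) Q∈B′)

  two-tangents⇒¬semioval : ∀ {K P L M} → P ∈ K → P on L → P on M → Tangent K L → Tangent K M →
                           L ≢ M → ¬ IsSemioval K
  two-tangents⇒¬semioval P∈K P-on-L P-on-M L-tangent M-tangent L≢M semioval =
    let _ , _ , _ , unique = semioval _ P∈K
    in L≢M (trans (unique _ P-on-L L-tangent) (sym (unique _ P-on-M M-tangent)))

record Split {q : ℕ} (F : FieldOn q) : Set where
  open FieldOn F
  field
    axial diagonal : List (Fin q)
    unique         : Unique (0# ∷ axial ++ diagonal)
    complete       : ∀ x → x ∈ 0# ∷ axial ++ diagonal
    1∈diagonal     : 1# ∈ diagonal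
    -1∈diagonal    : - 1# ∈ diagonal

module _ {q : ℕ} (F : FieldOn q) where
  open FieldOn F
  open FieldProperties F
  open import Data.List.Membership.DecPropositional (_≟_ {q}) using (_∈?_)
  open import Data.List.Relation.Unary.Unique.DecPropositional.Properties (_≟_ {q}) using (deduplicate-!)

  private
    units : List (Fin q)
    units = 1# ∷ - 1# ∷ []

    -- in characteristic 2, 1 = -1
    ±1 : List (Fin q)
    ±1 = deduplicate _≟_ units

    ordinary? : Decidable (_∉ 0# ∷ ±1)
    ordinary? x = ¬? (x ∈? 0# ∷ ±1)

    others : List (Fin q)
    others = filter ordinary? (allFin q)

    ordinary : ∀ {x} → x ∈ others → x ∉ 0# ∷ ±1
    ordinary = proj₂ ∘ ∈-filter⁻ ordinary? {xs = allFin q}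

    0∉others++±1 : 0# ∉ others ++ ±1
    0∉others++±1 0∈ with ∈-++⁻ others 0∈
    ... | inj₁ 0∈others = ordinary 0∈others (here refl)
    ... | inj₂ 0∈±1 with ∈-deduplicate⁻ _≟_ units 0∈±1
    ...   | here 0≡1         = 1≢0 (sym 0≡1)
    ...   | there (here 0≡-1) = -1≢0 (sym 0≡-1)

    enumeration-unique : Unique (0# ∷ others ++ ±1)
    enumeration-unique = All.¬Any⇒All¬ _ 0∉others++±1
                       ∷ Unique.++⁺ (Unique.filter⁺ ordinary? (Unique.allFin⁺ q)) (deduplicate-! units)
                                    (λ (x∈others , x∈±1) → ordinary x∈others (there x∈±1))

    enumeration-complete : ∀ x → x ∈ 0# ∷ others ++ ±1
    enumeration-complete x with x ∈? 0# ∷ ±1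
    ... | yes (here x≡0)    = here x≡0
    ... | yes (there x∈±1) = there (∈-++⁺ʳ others x∈±1)
    ... | no x∉            = there (∈-++⁺ˡ (∈-filter⁺ ordinary? (∈-allFin x) x∉))

    q≤|others|+3 : q ≤ length others ℕ.+ 3
    q≤|others|+3 = begin
      q                                 ≡⟨ unique-complete⇒length enumeration-unique enumeration-complete ⟨
      suc (length (others ++ ±1))       ≡⟨ cong suc (length-++ others) ⟩
      suc (length others ℕ.+ length ±1) ≤⟨ s≤s (+-monoʳ-≤ _ (length-deduplicate _≟_ units)) ⟩
      suc (length others ℕ.+ 2)         ≡⟨ +-suc (length others) 2 ⟨
      length others ℕ.+ 3               ∎
      where open ≤-Reasoning

  ∃-split : ∀ m → m ℕ.+ 3 ≤ q → Σ (Split F) λ σ → length (Split.axial σ) ≡ m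
  ∃-split m m+3≤q = record
    { axial       = take m others
    ; diagonal    = drop m others ++ ±1
    ; unique      = subst (Unique ∘ (0# ∷_)) regroup enumeration-unique
    ; complete    = λ x → subst ((x ∈_) ∘ (0# ∷_)) regroup (enumeration-complete x)
    ; 1∈diagonal  = ∈-++⁺ʳ (drop m others) (∈-deduplicate⁺ _≟_ {xs = units} (here refl))
    ; -1∈diagonal = ∈-++⁺ʳ (drop m others) (∈-deduplicate⁺ _≟_ {xs = units} (there (here refl)))
    } , trans (length-take m others) (m≤n⇒m⊓n≡m (+-cancelʳ-≤ 3 m _ (≤-trans m+3≤q q≤|others|+3)))
    where
      regroup : others ++ ±1 ≡ take m others ++ (drop m others ++ ±1)
      regroup = trans (cong (_++ ±1) (sym (take++drop≡id m others))) (++-assoc (take m others) _ _)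

module Construction {q : ℕ} (F : FieldOn q) (σ : Split F) where
  open FieldOn F
  open FieldProperties F
  open Incidence F
  open PG F
  open PlaneProperties F
  open Split σ

  nonzero : List (Fin q)
  nonzero = axial ++ diagonal

  nonzero! : Unique nonzero
  nonzero! = AllPairs.tail unique

  axial! : Unique axial
  axial! = proj₁ (Unique-++⁻ axial nonzero!)

  diagonal! : Unique diagonal
  diagonal! = proj₁ (proj₂ (Unique-++⁻ axial nonzero!))

  axial∩diagonal : Disjoint axial diagonal
  axial∩diagonal = proj₂ (proj₂ (Unique-++⁻ axial nonzero!))

  nonzero⁻ : ∀ {x} → x ∈ nonzero → x ≢ 0#
  nonzero⁻ x∈ refl = Unique.Unique[x∷xs]⇒x∉xs unique x∈

  axial-nonzero : ∀ {x} → x ∈ axial → x ≢ 0#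
  axial-nonzero = nonzero⁻ ∘ ∈-++⁺ˡ

  diagonal-nonzero : ∀ {x} → x ∈ diagonal → x ≢ 0#
  diagonal-nonzero = nonzero⁻ ∘ ∈-++⁺ʳ axial

  axial⊎diagonal : ∀ {x} → x ≢ 0# → x ∈ axial ⊎ x ∈ diagonal
  axial⊎diagonal {x} x≢0 with complete x
  ... | here x≡0   = ⊥-elim (x≢0 x≡0)
  ... | there x∈ = ∈-++⁻ axial x∈

  xPoint yPoint dPoint : Fin q → Point
  xPoint c = pt1 c 0#
  yPoint c = pt1 0# c
  dPoint c = pt1 c c

  families : List PointSet
  families = map pt2 nonzero ∷ map xPoint axial ∷ map yPoint axial ∷ map dPoint diagonal ∷ []

  B : PointSet
  B = concat families

  data InB : Point → Set where
    at-infinity : ∀ {b} → b ≢ 0# → InB (pt2 b)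
    on-x-axis   : ∀ {c} → c ∈ axial → InB (xPoint c)
    on-y-axis   : ∀ {c} → c ∈ axial → InB (yPoint c)
    on-diagonal : ∀ {c} → c ∈ diagonal → InB (dPoint c)

  InB⇒∈B : ∀ {P} → InB P → P ∈ B
  InB⇒∈B = ∈-concat⁺ ∘ family
    where
      family : ∀ {P} → InB P → Any (P ∈_) families
      family (at-infinity {b} b≢0) with axial⊎diagonal b≢0
      ... | inj₁ b∈ = here (∈-map⁺ pt2 (∈-++⁺ˡ b∈))
      ... | inj₂ b∈ = here (∈-map⁺ pt2 (∈-++⁺ʳ axial b∈))
      family (on-x-axis c∈)   = there (here (∈-map⁺ xPoint c∈))
      family (on-y-axis c∈)   = there (there (here (∈-map⁺ yPoint c∈)))
      family (on-diagonal c∈) = there (there (there (here (∈-map⁺ dPoint c∈))))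

  ∈B⇒InB : ∀ {P} → P ∈ B → InB P
  ∈B⇒InB P∈B with ∈-concat⁻ families P∈B
  ... | here P∈ with b , b∈ , refl ← ∈-map⁻ pt2 P∈ = at-infinity (nonzero⁻ b∈)
  ... | there (here P∈) with c , c∈ , refl ← ∈-map⁻ xPoint P∈ = on-x-axis c∈
  ... | there (there (here P∈)) with c , c∈ , refl ← ∈-map⁻ yPoint P∈ = on-y-axis c∈
  ... | there (there (there (here P∈))) with c , c∈ , refl ← ∈-map⁻ dPoint P∈ = on-diagonal c∈

  B-unique : Unique B
  B-unique = Unique.concat⁺
    (Unique.map⁺ pt2-injective nonzero! All.∷ Unique.map⁺ (cong coord₁) axial!
      All.∷ Unique.map⁺ (cong coord₂) axial! All.∷ Unique.map⁺ (cong coord₁) diagonal! All.∷ All.[])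
    ((map-disjoint (λ _ _ ()) All.∷ map-disjoint (λ _ _ ()) All.∷ map-disjoint (λ _ _ ()) All.∷ All.[])
      ∷ (x∩y All.∷ x∩d All.∷ All.[]) ∷ (y∩d All.∷ All.[]) ∷ All.[] ∷ [])
    where
      pt2-injective : ∀ {x y} → pt2 x ≡ pt2 y → x ≡ y
      pt2-injective refl = refl

      x∩y : Disjoint (map xPoint axial) (map yPoint axial)
      x∩y = map-disjoint λ c∈ _ → λ { refl → axial-nonzero c∈ refl }

      x∩d : Disjoint (map xPoint axial) (map dPoint diagonal)
      x∩d = map-disjoint λ _ c∈ → λ { refl → diagonal-nonzero c∈ refl }

      y∩d : Disjoint (map yPoint axial) (map dPoint diagonal)
      y∩d = map-disjoint λ _ c∈ → λ { refl → diagonal-nonzero c∈ refl }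

  -- vertical a is the affine line 1 + a x = 0, i.e. x = - a⁻¹; horizontal a is y = - a⁻¹
  vertical horizontal : Fin q → Line
  vertical a   = pt1 a 0#
  horizontal a = pt1 0# a

  -- AxialOrDiagonal xPoint c P: P is the point of B on the line x = c; likewise yPoint and y = c
  AxialOrDiagonal : (Fin q → Point) → Fin q → Point → Set
  AxialOrDiagonal f c P = c ∈ axial × P ≡ f c ⊎ c ∈ diagonal × P ≡ dPoint c

  AxialOrDiagonal-unique : ∀ {f c P Q} → AxialOrDiagonal f c P → AxialOrDiagonal f c Q → P ≡ Q
  AxialOrDiagonal-unique (inj₁ (_ , refl)) (inj₁ (_ , refl)) = refl
  AxialOrDiagonal-unique (inj₂ (_ , refl)) (inj₂ (_ , refl)) = refl
  AxialOrDiagonal-unique (inj₁ (c∈ , _)) (inj₂ (c∈′ , _)) = ⊥-elim (axial∩diagonal (c∈ , c∈′))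
  AxialOrDiagonal-unique (inj₂ (c∈′ , _)) (inj₁ (c∈ , _)) = ⊥-elim (axial∩diagonal (c∈ , c∈′))

  x-section : ∀ {c} → c ≢ 0# → Σ Point λ P → InB P × AxialOrDiagonal xPoint c P
  x-section {c} c≢0 with axial⊎diagonal c≢0
  ... | inj₁ c∈ = xPoint c , on-x-axis c∈ , inj₁ (c∈ , refl)
  ... | inj₂ c∈ = dPoint c , on-diagonal c∈ , inj₂ (c∈ , refl)

  y-section : ∀ {c} → c ≢ 0# → Σ Point λ P → InB P × AxialOrDiagonal yPoint c P
  y-section {c} c≢0 with axial⊎diagonal c≢0
  ... | inj₁ c∈ = yPoint c , on-y-axis c∈ , inj₁ (c∈ , refl)
  ... | inj₂ c∈ = dPoint c , on-diagonal c∈ , inj₂ (c∈ , refl)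

  affine-on-vertical⁺ : ∀ {a x y} → 1# + a * x ≡ 0# → pt1 x y on vertical a
  affine-on-vertical⁺ {a} {x} {y} e = on⁺ (vertical a) (pt1 x y) (trans (x+0y≡x _ y) e)

  affine-on-vertical⁻ : ∀ {a x y} → pt1 x y on vertical a → 1# + a * x ≡ 0#
  affine-on-vertical⁻ {a} {x} {y} P-on = trans (sym (x+0y≡x _ y)) (on⁻ (vertical a) (pt1 x y) P-on)

  affine-on-horizontal⁺ : ∀ {a x y} → 1# + a * y ≡ 0# → pt1 x y on horizontal a
  affine-on-horizontal⁺ {a} {x} {y} e =
    on⁺ (horizontal a) (pt1 x y) (trans (cong (_+ a * y) (x+0y≡x 1# x)) e)

  affine-on-horizontal⁻ : ∀ {a x y} → pt1 x y on horizontal a → 1# + a * y ≡ 0#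
  affine-on-horizontal⁻ {a} {x} {y} P-on =
    trans (cong (_+ a * y) (sym (x+0y≡x 1# x))) (on⁻ (horizontal a) (pt1 x y) P-on)

  on-vertical⁺ : ∀ {a c P} → 1# + a * c ≡ 0# → AxialOrDiagonal xPoint c P → P on vertical a
  on-vertical⁺ e (inj₁ (_ , refl)) = affine-on-vertical⁺ e
  on-vertical⁺ e (inj₂ (_ , refl)) = affine-on-vertical⁺ e

  on-horizontal⁺ : ∀ {a c P} → 1# + a * c ≡ 0# → AxialOrDiagonal yPoint c P → P on horizontal a
  on-horizontal⁺ e (inj₁ (_ , refl)) = affine-on-horizontal⁺ e
  on-horizontal⁺ e (inj₂ (_ , refl)) = affine-on-horizontal⁺ e

  on-vertical⁻ : ∀ {a P} → a ≢ 0# → InB P → P on vertical a →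
                 ∃ λ c → 1# + a * c ≡ 0# × AxialOrDiagonal xPoint c P
  on-vertical⁻ {a} a≢0 (at-infinity {b} _) P-on =
    ⊥-elim (a≢0 (trans (sym (x+0y≡x a b)) (on⁻ (vertical a) (pt2 b) P-on)))
  on-vertical⁻ {a} _ (on-y-axis _) P-on =
    ⊥-elim (1≢0 (trans (sym (x+y0≡x 1# a)) (affine-on-vertical⁻ P-on)))
  on-vertical⁻ _ (on-x-axis {c} c∈)   P-on = c , affine-on-vertical⁻ P-on , inj₁ (c∈ , refl)
  on-vertical⁻ _ (on-diagonal {c} c∈) P-on = c , affine-on-vertical⁻ P-on , inj₂ (c∈ , refl)

  on-horizontal⁻ : ∀ {a P} → a ≢ 0# → InB P → P on horizontal a →
                   ∃ λ c → 1# + a * c ≡ 0# × AxialOrDiagonal yPoint c P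
  on-horizontal⁻ {a} a≢0 (at-infinity {b} b≢0) P-on =
    ⊥-elim (b≢0 (zero-product (trans (sym (+-identityˡ (a * b))) (on⁻ (horizontal a) (pt2 b) P-on)) a≢0))
  on-horizontal⁻ {a} _ (on-x-axis _) P-on =
    ⊥-elim (1≢0 (trans (sym (x+y0≡x 1# a)) (affine-on-horizontal⁻ P-on)))
  on-horizontal⁻ _ (on-y-axis {c} c∈)   P-on = c , affine-on-horizontal⁻ P-on , inj₁ (c∈ , refl)
  on-horizontal⁻ _ (on-diagonal {c} c∈) P-on = c , affine-on-horizontal⁻ P-on , inj₂ (c∈ , refl)

  record TangentAt (L : Line) (P : Point) : Set where
    constructor tangent-at
    field
      incident : P on L
      only     : ∀ {Q} → InB Q → Q on L → Q ≡ P

  TangentAt⇒Tangent : ∀ {L P} → InB P → TangentAt L P → Tangent B L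
  TangentAt⇒Tangent {P = P} P∈ (tangent-at P-on only) = P , InB⇒∈B P∈ , P-on , λ Q Q∈ → only (∈B⇒InB Q∈)

  vertical-tangent : ∀ {a c P} → 1# + a * c ≡ 0# → AxialOrDiagonal xPoint c P → TangentAt (vertical a) P
  vertical-tangent e P∼ = tangent-at (on-vertical⁺ e P∼) λ Q∈ Q-on →
    let _ , e′ , Q∼ = on-vertical⁻ (linear-coefficient-nonzero 1≢0 e) Q∈ Q-on
    in AxialOrDiagonal-unique {f = xPoint}
         (subst (λ c → AxialOrDiagonal xPoint c _) (root-unique e′ e) Q∼) P∼

  horizontal-tangent : ∀ {a c P} → 1# + a * c ≡ 0# → AxialOrDiagonal yPoint c P →
                       TangentAt (horizontal a) P
  horizontal-tangent e P∼ = tangent-at (on-horizontal⁺ e P∼) λ Q∈ Q-on →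
    let _ , e′ , Q∼ = on-horizontal⁻ (linear-coefficient-nonzero 1≢0 e) Q∈ Q-on
    in AxialOrDiagonal-unique {f = yPoint}
         (subst (λ c → AxialOrDiagonal yPoint c _) (root-unique e′ e) Q∼) P∼

  -- the line y = x + 1 meets the axes in (-1,0) and (0,1), which are not in B as ±1 are diagonal
  slope-1-tangent : TangentAt (pt1 1# (- 1#)) (pt2 1#)
  slope-1-tangent = tangent-at (on⁺ L (pt2 1#) 1+-1·1≡0) only
    where
      L = pt1 1# (- 1#)
      only : ∀ {Q} → InB Q → Q on L → Q ≡ pt2 1#
      only (at-infinity {y} _) Q-on = cong pt2 (linear-unique -1≢0 (on⁻ L (pt2 y) Q-on) 1+-1·1≡0)
      only (on-x-axis {c} c∈) Q-on = ⊥-elim (axial∩diagonal (subst (_∈ axial) c≡-1 c∈ , -1∈diagonal))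
        where
          c≡-1 : c ≡ - 1#
          c≡-1 = linear-unique 1≢0 (trans (sym (x+y0≡x _ (- 1#))) (on⁻ L (xPoint c) Q-on)) 1+1·-1≡0
      only (on-y-axis {c} c∈) Q-on = ⊥-elim (axial∩diagonal (subst (_∈ axial) c≡1 c∈ , 1∈diagonal))
        where
          c≡1 : c ≡ 1#
          c≡1 = linear-unique -1≢0
                  (trans (cong (_+ - 1# * c) (sym (x+y0≡x 1# 1#))) (on⁻ L (yPoint c) Q-on)) 1+-1·1≡0
      only (on-diagonal {c} _) Q-on = ⊥-elim (1≢0 (trans (sym (1+x-x≡1 c)) (on⁻ L (dPoint c) Q-on)))

  -- a line through the origin meets the axes only there, and the diagonal too unless its slope is 1
  central-tangent : ∀ {b c} → b ≢ 1# → 1# + c * b ≡ 0# → TangentAt (pt2 c) (pt2 b)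
  central-tangent {b} {c} b≢1 e = tangent-at (on⁺ (pt2 c) (pt2 b) e) only
    where
      c≢0 : c ≢ 0#
      c≢0 = linear-coefficient-nonzero 1≢0 e

      only : ∀ {Q} → InB Q → Q on pt2 c → Q ≡ pt2 b
      only (at-infinity {y} _) Q-on = cong pt2 (linear-unique c≢0 (on⁻ (pt2 c) (pt2 y) Q-on) e)
      only (on-x-axis {x} x∈) Q-on =
        ⊥-elim (axial-nonzero x∈ (trans (sym (x+y0≡x x c)) (on⁻ (pt2 c) (xPoint x) Q-on)))
      only (on-y-axis {y} y∈) Q-on =
        ⊥-elim (axial-nonzero y∈
          (zero-product (trans (sym (+-identityˡ (c * y))) (on⁻ (pt2 c) (yPoint y) Q-on)) c≢0))
      only (on-diagonal {x} x∈) Q-on = ⊥-elim (b≢1 (linear-unique c≢0 e 1+c·1≡0))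
        where
          x[1+c]≡0 : x * (1# + c) ≡ 0#
          x[1+c]≡0 = trans (*-comm x _) (trans (sym (x+cx≡[1+c]x c x)) (on⁻ (pt2 c) (dPoint x) Q-on))

          1+c·1≡0 : 1# + c * 1# ≡ 0#
          1+c·1≡0 = trans (cong (1# +_) (*-identityʳ c)) (zero-product x[1+c]≡0 (diagonal-nonzero x∈))

  tangent : ∀ {P} → InB P → Σ Line λ L → TangentAt L P
  tangent (at-infinity {b} b≢0) with b ≟ 1#
  ... | yes refl = pt1 1# (- 1#) , slope-1-tangent
  ... | no b≢1   = let c , e = ∃-coefficient b≢0 in pt2 c , central-tangent b≢1 e
  tangent (on-x-axis c∈) =
    let a , e = ∃-coefficient (axial-nonzero c∈)
    in vertical a , vertical-tangent e (inj₁ (c∈ , refl))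
  tangent (on-y-axis c∈) =
    let a , e = ∃-coefficient (axial-nonzero c∈)
    in horizontal a , horizontal-tangent e (inj₁ (c∈ , refl))
  tangent (on-diagonal c∈) =
    let a , e = ∃-coefficient (diagonal-nonzero c∈)
    in vertical a , vertical-tangent e (inj₂ (c∈ , refl))

  meets : ∀ {c} → c ∈ axial → ∀ L → Σ Point λ P → InB P × P on L
  meets {c} c∈ pt3 = xPoint c , on-x-axis c∈ , on⁺ pt3 (xPoint c) refl
  meets {c} c∈ (pt2 b) with b ≟ 0#
  ... | yes refl = yPoint c , on-y-axis c∈ , on⁺ (pt2 0#) (yPoint c) (x+0y≡x 0# c)
  ... | no b≢0   =
    let y , e = linear-solvable 1# b≢0
    in pt2 y , at-infinity (linear-root-nonzero 1≢0 e) , on⁺ (pt2 b) (pt2 y) e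
  meets _ (pt1 a b) with a ≟ 0# | b ≟ 0#
  ... | yes refl | yes refl = pt2 1# , at-infinity 1≢0 , on⁺ (pt1 0# 0#) (pt2 1#) (x+0y≡x 0# 1#)
  ... | no a≢0   | yes refl =
    let x , e = linear-solvable 1# a≢0
        P , P∈ , P∼ = x-section (linear-root-nonzero 1≢0 e)
    in P , P∈ , on-vertical⁺ e P∼
  ... | yes refl | no b≢0   =
    let y , e = linear-solvable 1# b≢0
        P , P∈ , P∼ = y-section (linear-root-nonzero 1≢0 e)
    in P , P∈ , on-horizontal⁺ e P∼
  ... | no a≢0   | no b≢0   =
    let y , e = linear-solvable a b≢0
    in pt2 y , at-infinity (linear-root-nonzero a≢0 e) , on⁺ (pt1 a b) (pt2 y) e

  ¬InB-origin : ¬ InB (pt1 0# 0#)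
  ¬InB-origin (on-x-axis c∈)   = axial-nonzero c∈ refl
  ¬InB-origin (on-y-axis c∈)   = axial-nonzero c∈ refl
  ¬InB-origin (on-diagonal c∈) = diagonal-nonzero c∈ refl

  ¬InB-off-lines : ∀ {x y} → x ≢ 0# → y ≢ 0# → x ≢ y → ¬ InB (pt1 x y)
  ¬InB-off-lines _   y≢0 _   (on-x-axis _)   = y≢0 refl
  ¬InB-off-lines x≢0 _   _   (on-y-axis _)   = x≢0 refl
  ¬InB-off-lines _   _   x≢y (on-diagonal _) = x≢y refl

  -- x must avoid 0 and the abscissae where the line meets the x-axis and the diagonal
  nonvertical-avoids : 3 < q → ∀ a {b} → b ≢ 0# → Σ Point λ P → P on pt1 a b × ¬ InB P
  nonvertical-avoids 3<q a {b} b≢0 =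
    let x , x-allowed = ∃-avoiding 3<q excluded excluded? excluded-unique
        y , e = linear-solvable (1# + a * x) b≢0
        x≢y : x ≢ y
        x≢y x≡y = x-allowed (suc (suc zero))
          (trans (sym (1+ax+bx≡1+[a+b]x a b x)) (subst (λ z → 1# + a * x + b * z ≡ 0#) (sym x≡y) e))
    in pt1 x y , on⁺ (pt1 a b) (pt1 x y) e ,
       ¬InB-off-lines (x-allowed zero) (linear-root-nonzero (x-allowed (suc zero)) e) x≢y
    where
      excluded : Fin 3 → Pred (Fin q) _
      excluded zero             x = x ≡ 0#
      excluded (suc zero)       x = 1# + a * x ≡ 0#
      excluded (suc (suc zero)) x = 1# + (a + b) * x ≡ 0#

      excluded? : ∀ i → Decidable (excluded i)
      excluded? zero             x = x ≟ 0#
      excluded? (suc zero)       x = 1# + a * x ≟ 0#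
      excluded? (suc (suc zero)) x = 1# + (a + b) * x ≟ 0#

      excluded-unique : ∀ i → AtMostOne (excluded i)
      excluded-unique zero             s≡0 t≡0 = trans s≡0 (sym t≡0)
      excluded-unique (suc zero)       = root-unique
      excluded-unique (suc (suc zero)) = root-unique

  avoids : 3 < q → ∀ L → Σ Point λ P → P on L × ¬ InB P
  avoids _ pt3     = pt1 0# 0# , on⁺ pt3 (pt1 0# 0#) refl , ¬InB-origin
  avoids _ (pt2 b) = pt1 0# 0# , on⁺ (pt2 b) (pt1 0# 0#) (x+y0≡x 0# b) , ¬InB-origin
  avoids 3<q (pt1 a b) with b ≟ 0#
  ... | yes refl = pt3 , on⁺ (pt1 a 0#) pt3 refl , λ ()
  ... | no b≢0   = nonvertical-avoids 3<q a b≢0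

  B-blocking : 3 < q → ∀ {c} → c ∈ axial → IsBlockingSet B
  B-blocking 3<q c∈ = (λ L → let P , P∈ , P-on = meets c∈ L in P , InB⇒∈B P∈ , P-on)
                    , (λ L → let P , P-on , P∉ = avoids 3<q L in P , P-on , P∉ ∘ ∈B⇒InB)

  B-minimal : 3 < q → ∀ {c} → c ∈ axial → IsMinimalBlockingSet B
  B-minimal 3<q c∈ = tangents-everywhere⇒minimal (B-blocking 3<q c∈) λ P P∈B →
    let L , P-tangent = tangent (∈B⇒InB P∈B)
    in L , TangentAt.incident P-tangent , TangentAt⇒Tangent (∈B⇒InB P∈B) P-tangent

  x-axis-r∞ : ∀ {c₁ c₂} → c₁ ∈ axial → c₂ ∈ axial → c₁ ≢ c₂ → HasRInfProperty B (xPoint c₁)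
  x-axis-r∞ {c₁} {c₂} c₁∈ c₂∈ c₁≢c₂ =
    let a , e = ∃-coefficient (axial-nonzero c₁∈)
        V-tangent = vertical-tangent e (inj₁ (c₁∈ , refl))
    in InB⇒∈B P∈ , vertical a , TangentAt.incident V-tangent , TangentAt⇒Tangent P∈ V-tangent , secant e
    where
      P∈ = on-x-axis c₁∈

      secant-through : ∀ M {P Q} → InB P → InB Q → P ≢ Q → P on M → Q on M → Secant B M
      secant-through _ P∈ Q∈ P≢Q P-on Q-on = _ , _ , P≢Q , InB⇒∈B P∈ , InB⇒∈B Q∈ , P-on , Q-on

      secant : ∀ {a} → 1# + a * c₁ ≡ 0# → ∀ M → xPoint c₁ on M → M ≢ vertical a → Secant B M
      secant _ pt3 _ _ = secant-through pt3 P∈ (on-x-axis c₂∈) (c₁≢c₂ ∘ cong coord₁)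
                                        (on⁺ pt3 (xPoint c₁) refl) (on⁺ pt3 (xPoint c₂) refl)
      secant _ (pt2 b) P-on _ =
        ⊥-elim (axial-nonzero c₁∈ (trans (sym (x+y0≡x c₁ b)) (on⁻ (pt2 b) (xPoint c₁) P-on)))
      secant e (pt1 a′ b′) P-on M≢V with b′ ≟ 0#
      ... | yes refl = ⊥-elim (M≢V (cong vertical (coefficient-unique e′ e)))
        where
          e′ = affine-on-vertical⁻ P-on
      ... | no b′≢0 =
        let y , e″ = linear-solvable a′ b′≢0
        in secant-through (pt1 a′ b′) P∈ (at-infinity (linear-root-nonzero a′≢0 e″)) (λ ())
                          P-on (on⁺ (pt1 a′ b′) (pt2 y) e″)
        where
          a′≢0 = linear-coefficient-nonzero 1≢0
                   (trans (sym (x+y0≡x _ b′)) (on⁻ (pt1 a′ b′) (xPoint c₁) P-on))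

  B-¬semioval : ¬ IsSemioval B
  B-¬semioval =
    let a , e = ∃-coefficient 1≢0
        P∈ = on-diagonal 1∈diagonal
        V-tangent = vertical-tangent e (inj₂ (1∈diagonal , refl))
        H-tangent = horizontal-tangent e (inj₂ (1∈diagonal , refl))
    in two-tangents⇒¬semioval {L = vertical a} {M = horizontal a} (InB⇒∈B P∈)
         (TangentAt.incident V-tangent) (TangentAt.incident H-tangent)
         (TangentAt⇒Tangent P∈ V-tangent) (TangentAt⇒Tangent P∈ H-tangent)
         (λ V≡H → linear-coefficient-nonzero 1≢0 e (cong coord₁ V≡H))

open import Data.Nat using (_+_; _*_; _∸_)
open import Data.Nat.Properties
  using (+-comm; +-assoc; +-cancelʳ-≡; +-cancelˡ-≤; +-monoˡ-≤; m∸n+n≡m; m≤m+n; n≤1+n)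

module _ {q : ℕ} (F : FieldOn q) (σ : Split F) where
  open Construction F σ using (B; families; nonzero)
  open Split σ

  length-B : length B + 2 ≡ 2 * q + length axial
  length-B = begin
    length B + 2                      ≡⟨ cong (_+ 2) (trans (length-concat families) family-sizes) ⟩
    (X + D) + (X + (X + (D + 0))) + 2 ≡⟨ count X D ⟩
    2 * suc (X + D) + X               ≡⟨ cong (λ n → 2 * n + X) |0∷nonzero| ⟩
    2 * q + X                         ∎
    where
      open ≡-Reasoning
      X = length axial
      D = length diagonal

      family-sizes : sum (map length families) ≡ (X + D) + (X + (X + (D + 0)))
      family-sizes = cong₂ _+_ (trans (length-map pt2 nonzero) (length-++ axial))
        (cong₂ _+_ (length-map _ axial)
          (cong₂ _+_ (length-map _ axial) (cong (_+ 0) (length-map _ diagonal))))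
        where open PG F using (pt2)

      count : ∀ X D → (X + D) + (X + (X + (D + 0))) + 2 ≡ 2 * suc (X + D) + X
      count = solve-∀

      |0∷nonzero| : suc (X + D) ≡ q
      |0∷nonzero| = trans (cong suc (sym (length-++ axial))) (unique-complete⇒length unique complete)

axial-size-bound : ∀ {q j} → 5 ≤ q → 2 * q + j ≤ 3 * q ∸ 5 → (2 + j) + 3 ≤ q
axial-size-bound {q} {j} 5≤q 2q+j≤3q∸5 = +-cancelˡ-≤ (2 * q) _ _ (begin
  2 * q + ((2 + j) + 3)  ≡⟨ regroup q j ⟩
  2 * q + j + 5          ≤⟨ +-monoˡ-≤ 5 2q+j≤3q∸5 ⟩
  3 * q ∸ 5 + 5          ≡⟨ m∸n+n≡m (≤-trans 5≤q (m≤m+n q (2 * q))) ⟩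
  3 * q                  ≡⟨ 3q≡2q+q q ⟩
  2 * q + q              ∎)
  where
    open ≤-Reasoning
    regroup : ∀ q j → 2 * q + ((2 + j) + 3) ≡ 2 * q + j + 5
    regroup = solve-∀
    3q≡2q+q : ∀ q → 3 * q ≡ 2 * q + q
    3q≡2q+q = solve-∀

theorem3p10 : (q : ℕ) → IsPrimePower q → 5 ≤ q → (F : FieldOn q) →
    (k : ℕ) → 2 * q ≤ k → k ≤ 3 * q ∸ 5 →
    Σ (PG.PointSet F) λ B →
      Unique B × length B ≡ k ×
      PG.IsMinimalBlockingSet F B ×
      (Σ (PG.Point F) λ P → PG.HasRInfProperty F B P) ×
      ¬ PG.IsBlockingSemioval F B
theorem3p10 q _ 5≤q F k 2q≤k k≤3q∸5 with j , refl ← m≤n⇒∃[o]m+o≡n 2q≤k =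
  let σ , |axial|≡2+j = ∃-split F (2 + j) (axial-size-bound 5≤q k≤3q∸5)
      open Construction F σ
      c₁ , c₂ , c₁∈ , c₂∈ , c₁≢c₂ = distinct-pair axial! (subst (2 ≤_) (sym |axial|≡2+j) (m≤m+n 2 j))
      3<q = ≤-trans (n≤1+n 4) 5≤q
      |B|≡k = +-cancelʳ-≡ 2 _ _ (trans (length-B F σ)
                (trans (cong (2 * q +_) (trans |axial|≡2+j (+-comm 2 j))) (sym (+-assoc (2 * q) j 2))))
  in B , B-unique , |B|≡k , B-minimal 3<q c₁∈ , (xPoint c₁ , x-axis-r∞ c₁∈ c₂∈ c₁≢c₂) ,
     B-¬semioval ∘ proj₂
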